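{- Let $G$ be a finite simple graph, $v_0 \in V(G)$, and $P$ a longest $v_0$-path in $G$. For every $v \in L(G,P,v_0)$, the degree of $v$ satisfies $d(v) \leq |L(G,P,v_0)|$.
   Context: A $v_0$-path is a path starting at $v_0$; its other end is its terminal vertex; a longest $v_0$-path is one of maximum length among $v_0$-paths. If $Q = v_0v_1\dots v_k$ is a longest $v_0$-path and $v_k$ is adjacent to $v_j$ for some $0 \le j \le k-2$, the path $v_0v_1\dots v_jv_kv_{k-1}\dots v_{j+1}$ is a simple transform of $Q$. A transform of $P$ is any path obtained from $P$ by a finite sequence of simple transforms. $L(G,P,v_0)$ is the set of terminal vertices of transforms of $P$. -}

module Defs where

open import Data.Nat using (ℕ; _≤_; suc)
open import Data.Nat.ListAction using (sum)
open import Data.Fin using (Fin)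
open import Data.Bool using (Bool; true; false; if_then_else_)
open import Data.List using (List; []; _∷_; _++_; _∷ʳ_; reverse; length; map; last; allFin)
open import Data.List.Relation.Unary.Unique.Propositional using (Unique)
open import Data.List.Relation.Unary.Linked using (Linked)
open import Data.List.Membership.Propositional using (_∈_)
open import Data.Maybe using (just)
open import Data.Product using (Σ; ∃; _×_)
open import Relation.Binary.PropositionalEquality using (_≡_)
open import Relation.Nullary using (¬_)

record SimpleGraph (n : ℕ) : Set where
  field
    adj   : Fin n → Fin n → Bool
    sym   : ∀ u v → adj u v ≡ adj v u
    irrefl : ∀ v → adj v v ≡ false
open SimpleGraph public

module _ {n : ℕ} (G : SimpleGraph n) where

  Adj : Fin n → Fin n → Set
  Adj u v = adj G u v ≡ true

  degree : Fin n → ℕ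
  degree v = sum (map (λ w → if adj G v w then 1 else 0) (allFin n))

  IsPath : List (Fin n) → Set
  IsPath vs = Unique vs × Linked Adj vs

  IsV0Path : Fin n → List (Fin n) → Set
  IsV0Path v0 Q = Σ (List (Fin n)) λ rest → Q ≡ v0 ∷ rest × IsPath Q

  -- a longest v0-path (length = number of vertices - 1, so comparing list lengths is the same)
  IsLongestV0Path : Fin n → List (Fin n) → Set
  IsLongestV0Path v0 P = IsV0Path v0 P × (∀ Q → IsV0Path v0 Q → length Q ≤ length P)

  -- simple transform: Q = v0 … vj v(j+1) … v(k-1) vk with vk ~ vj, j ≤ k-2,
  -- R = v0 … vj vk v(k-1) … v(j+1).  Q must be a longest v0-path.
  SimpleTransform : Fin n → List (Fin n) → List (Fin n) → Set
  SimpleTransform v0 Q R =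
    IsLongestV0Path v0 Q ×
    Σ (List (Fin n)) λ As → Σ (Fin n) λ vj → Σ (Fin n) λ u → Σ (List (Fin n)) λ Bs → Σ (Fin n) λ vk →
      (Q ≡ (As ∷ʳ vj) ++ ((u ∷ Bs) ∷ʳ vk)) × Adj vk vj ×
      (R ≡ (As ∷ʳ vj) ++ (vk ∷ reverse (u ∷ Bs)))

  data Transform (v0 : Fin n) (P : List (Fin n)) : List (Fin n) → Set where
    here : Transform v0 P P
    step : ∀ {Q R} → Transform v0 P Q → SimpleTransform v0 Q R → Transform v0 P R

  InL : Fin n → List (Fin n) → Fin n → Set
  InL v0 P v = Σ (List (Fin n)) λ Q → Transform v0 P Q × last Q ≡ just v

{-# OPTIONS --safe #-}
module Submission where

-- Every transform Q of P is again a longest v0-path: a simple transform only reverses a final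
-- segment, which permutes the vertices and keeps consecutive ones adjacent.  Let Q end at v.
-- By maximality every neighbour of v lies on Q, before v, so it has a successor on Q, and this
-- successor map is injective.  Each successor lies in L(G,P,v0): the successor of the
-- second-to-last vertex is v itself, and the successor of any earlier neighbour vj is the
-- terminal vertex of the simple transform of Q at vj.

open import Defs hiding (sym)
open import Data.Bool using (Bool; true; false; if_then_else_)
open import Data.Bool.Properties using () renaming (_≟_ to _≟ᵇ_)
open import Data.Fin using (Fin)
open import Data.Fin.Properties using () renaming (_≟_ to _≟ᶠ_)
open import Data.List using (List; []; _∷_; _++_; _∷ʳ_; [_]; reverse; reverseAcc; length; map; head; last; filter; allFin; initLast; _∷ʳ′_)
open import Data.List.Properties using (++-assoc; ∷ʳ-injective; unfold-reverse; reverse-++; length-removeAt′)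
open import Data.List.Membership.Propositional using (_∈_; _∉_)
open import Data.List.Membership.Propositional.Properties using (∈-++⁻; ∈-filter⁺; ∈-filter⁻)
open import Data.List.Relation.Binary.Subset.Propositional using (_⊆_)
open import Data.List.Relation.Binary.Permutation.Propositional using (_↭_; ↭-prep; ↭-trans; ↭-sym; ↭⇒↭ₛ)
open import Data.List.Relation.Binary.Permutation.Propositional.Properties using (↭-length; ↭-reverse; ∷↭∷ʳ; ++⁺ˡ)
import Data.List.Relation.Binary.Permutation.Setoid.Properties as Permutationₛ
import Data.List.Relation.Unary.All as All
import Data.List.Relation.Unary.AllPairs as AllPairs
open import Data.List.Relation.Unary.All.Properties using (¬Any⇒All¬)
open import Data.List.Relation.Unary.Any using (here; there; index; _─_; any?)
open import Data.List.Relation.Unary.Linked as Linked using (Linked; []; [-]; _∷_)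
import Data.List.Relation.Unary.Linked.Properties as Linkedₚ
open import Data.List.Relation.Unary.Unique.Propositional using (Unique; []; _∷_)
open import Data.List.Relation.Unary.Unique.Propositional.Properties using (filter⁺; allFin⁺)
open import Data.Maybe using (just)
open import Data.Maybe.Relation.Binary.Connected using (Connected; just)
open import Data.Nat using (ℕ; suc; _≤_; z≤n; s≤s)
open import Data.Nat.ListAction using (sum)
open import Data.Nat.Properties using (≤-trans; ≤-reflexive; n≮n; module ≤-Reasoning)
open import Data.Product using (∃; ∃₂; _×_; _,_; proj₂; map₁)
open import Data.Sum using (inj₁; inj₂)
open import Level using (Level)
open import Relation.Binary.Core using (Rel)
open import Relation.Binary.Definitions using (Symmetric)
open import Relation.Binary.PropositionalEquality using (_≡_; _≢_; refl; sym; trans; cong; subst; setoid; module ≡-Reasoning)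
open import Relation.Nullary using (yes; no; does; contradiction)
open import Relation.Unary using (Pred; Decidable)

private
  variable
    a p ℓ : Level
    A : Set a

Unique-resp-↭ : ∀ {xs ys : List A} → xs ↭ ys → Unique xs → Unique ys
Unique-resp-↭ {A = A} xs↭ys = Permutationₛ.Unique-resp-↭ (setoid A) (↭⇒↭ₛ xs↭ys)

∈-─ : ∀ {x z : A} {ys} (x∈ys : x ∈ ys) → z ∈ ys → z ≢ x → z ∈ (ys ─ x∈ys)
∈-─ (here refl)  (here refl)  z≢x = contradiction refl z≢x
∈-─ (here _)     (there z∈ys) _   = z∈ys
∈-─ (there _)    (here refl)  _   = here refl
∈-─ (there x∈ys) (there z∈ys) z≢x = there (∈-─ x∈ys z∈ys z≢x)

Unique∧⊆⇒length≤ : ∀ {xs ys : List A} → Unique xs → xs ⊆ ys → length xs ≤ length ys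
Unique∧⊆⇒length≤ {xs = []}     _             _     = z≤n
Unique∧⊆⇒length≤ {xs = x ∷ xs} {ys} (x∉xs ∷ xs!) xs⊆ys = begin
  suc (length xs)           ≤⟨ s≤s (Unique∧⊆⇒length≤ xs! xs⊆ys─x) ⟩
  suc (length (ys ─ x∈ys))  ≡⟨ length-removeAt′ ys (index x∈ys) ⟨
  length ys                 ∎
  where
  open ≤-Reasoning
  x∈ys = xs⊆ys (here refl)
  xs⊆ys─x : xs ⊆ (ys ─ x∈ys)
  xs⊆ys─x z∈xs = ∈-─ x∈ys (xs⊆ys (there z∈xs)) (λ z≡x → All.lookup x∉xs z∈xs (sym z≡x))

head-∷ʳ-++ : ∀ (xs : List A) x ys → head ((xs ∷ʳ x) ++ ys) ≡ head (xs ∷ʳ x)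
head-∷ʳ-++ []      _ _ = refl
head-∷ʳ-++ (_ ∷ _) _ _ = refl

last-∷ʳ : ∀ (xs : List A) x → last (xs ∷ʳ x) ≡ just x
last-∷ʳ []           _ = refl
last-∷ʳ (_ ∷ [])     _ = refl
last-∷ʳ (_ ∷ y ∷ xs) x = last-∷ʳ (y ∷ xs) x

last≡just⇒∷ʳ : ∀ (xs : List A) {x} → last xs ≡ just x → ∃ λ ys → xs ≡ ys ∷ʳ x
last≡just⇒∷ʳ (y ∷ [])     refl = [] , refl
last≡just⇒∷ʳ (y ∷ z ∷ xs) eq   with last≡just⇒∷ʳ (z ∷ xs) eq
... | ys , z∷xs≡ys∷ʳx = y ∷ ys , cong (y ∷_) z∷xs≡ys∷ʳx

module _ {R : Rel A ℓ} where

  Linked-++⁻ : ∀ xs {ys} → Linked R (xs ++ ys) → Linked R xs × Linked R ys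
  Linked-++⁻ []           l       = [] , l
  Linked-++⁻ (_ ∷ [])     l       = [-] , Linked.tail l
  Linked-++⁻ (_ ∷ y ∷ xs) (r ∷ l) = map₁ (r ∷_) (Linked-++⁻ (y ∷ xs) l)

  module _ (R-sym : Symmetric R) where

    Linked-reverse : ∀ {xs} → Linked R xs → Linked R (reverse xs)
    Linked-reverse {[]}    l = l
    Linked-reverse {_ ∷ _} l = Linked-reverseAcc [-] l
      where
      Linked-reverseAcc : ∀ {x xs ys} → Linked R (x ∷ ys) → Linked R (x ∷ xs) →
                          Linked R (reverseAcc (x ∷ ys) xs)
      Linked-reverseAcc l [-]      = l
      Linked-reverseAcc l (r ∷ l′) = Linked-reverseAcc (R-sym r ∷ l) l′

    Linked-reverse-suffix : ∀ xs {x y} ys → R y x → Linked R ((xs ∷ʳ x) ++ ys ∷ʳ y) →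
                            Linked R ((xs ∷ʳ x) ++ y ∷ reverse ys)
    Linked-reverse-suffix xs {x} {y} ys y~x l with Linked-++⁻ (xs ∷ʳ x) l
    ... | prefix-linked , suffix-linked =
      Linkedₚ.++⁺ prefix-linked
        (subst (λ m → Connected R m (just y)) (sym (last-∷ʳ xs x)) (just (R-sym y~x)))
        (subst (Linked R) (reverse-++ ys [ y ]) (Linked-reverse suffix-linked))

module _ {P : Pred A p} (P? : Decidable P) where

  successors : List A → List A
  successors (x ∷ y ∷ xs) = if does (P? x) then y ∷ successors (y ∷ xs) else successors (y ∷ xs)
  successors _            = []

  length-successors-∷ʳ : ∀ xs (y : A) → length (successors (xs ∷ʳ y)) ≡ length (filter P? xs)
  length-successors-∷ʳ []                 _ = refl
  length-successors-∷ʳ (x ∷ [])           _ with does (P? x)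
  ... | true  = refl
  ... | false = refl
  length-successors-∷ʳ (x ∷ x′ ∷ xs)     y with does (P? x) | length-successors-∷ʳ (x′ ∷ xs) y
  ... | true  | ih = cong suc ih
  ... | false | ih = ih

  successors-⊆ : ∀ x xs → successors (x ∷ xs) ⊆ xs
  successors-⊆ x (y ∷ xs) z∈ with does (P? x) | z∈
  ... | true  | here refl = here refl
  ... | true  | there z∈′ = there (successors-⊆ y xs z∈′)
  ... | false | z∈′       = there (successors-⊆ y xs z∈′)

  Unique-successors : ∀ xs → Unique xs → Unique (successors xs)
  Unique-successors []           _            = []
  Unique-successors (_ ∷ [])     _            = []
  Unique-successors (x ∷ y ∷ xs) (_ ∷ y∷xs!) with does (P? x)
  ... | true  = All.tabulate (λ z∈ → All.lookup (AllPairs.head y∷xs!) (successors-⊆ y xs z∈))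
                  ∷ Unique-successors (y ∷ xs) y∷xs!
  ... | false = Unique-successors (y ∷ xs) y∷xs!

  IsSuccessor : A → List A → Set _
  IsSuccessor z xs = ∃₂ λ as x → ∃ λ bs → xs ≡ (as ∷ʳ x) ++ z ∷ bs × P x

  IsSuccessor-∷ : ∀ {z x xs} → IsSuccessor z xs → IsSuccessor z (x ∷ xs)
  IsSuccessor-∷ {x = x} (as , x′ , bs , eq , px′) = x ∷ as , x′ , bs , cong (x ∷_) eq , px′

  ∈-successors⁻ : ∀ {z} xs → z ∈ successors xs → IsSuccessor z xs
  ∈-successors⁻ (x ∷ xs) = ∈-successors-∷⁻ x xs
    where
    ∈-successors-∷⁻ : ∀ {z} x xs → z ∈ successors (x ∷ xs) → IsSuccessor z (x ∷ xs)
    ∈-successors-∷⁻ x (y ∷ xs) z∈ with P? x | z∈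
    ... | yes px | here refl = [] , x , xs , refl , px
    ... | yes _  | there z∈′ = IsSuccessor-∷ (∈-successors-∷⁻ y xs z∈′)
    ... | no _   | z∈′       = IsSuccessor-∷ (∈-successors-∷⁻ y xs z∈′)

sum-map-indicator≡length-filter : ∀ (f : A → Bool) xs →
  sum (map (λ x → if f x then 1 else 0) xs) ≡ length (filter (λ x → f x ≟ᵇ true) xs)
sum-map-indicator≡length-filter f []       = refl
sum-map-indicator≡length-filter f (x ∷ xs) with f x
... | true  = cong suc (sum-map-indicator≡length-filter f xs)
... | false = sum-map-indicator≡length-filter f xs

module _ {n : ℕ} (G : SimpleGraph n) where

  Adj-sym : Symmetric (Adj G)
  Adj-sym {u} {v} u~v = trans (SimpleGraph.sym G v u) u~v

  Adj-irrefl : ∀ {u v} → Adj G u v → u ≢ v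
  Adj-irrefl {u} u~u refl with trans (sym u~u) (irrefl G u)
  ... | ()

  Adj? : ∀ u → Decidable (Adj G u)
  Adj? u w = adj G u w ≟ᵇ true

  neighbours : Fin n → List (Fin n)
  neighbours v = filter (Adj? v) (allFin n)

  degree≡length-neighbours : ∀ v → degree G v ≡ length (neighbours v)
  degree≡length-neighbours v = sum-map-indicator≡length-filter (adj G v) (allFin n)

  module _ {v0 : Fin n} where

    IsLongestV0Path-resp-↭ : ∀ {Q R} → IsLongestV0Path G v0 Q → Q ↭ R → head R ≡ head Q →
                             Linked (Adj G) R → IsLongestV0Path G v0 R
    IsLongestV0Path-resp-↭ {R = r ∷ rs} ((_ , refl , Q! , _) , Q-max) Q↭R refl R-linked =
      (rs , refl , Unique-resp-↭ Q↭R Q! , R-linked) ,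
      λ Q′ Q′-path → ≤-trans (Q-max Q′ Q′-path) (≤-reflexive (↭-length Q↭R))

    simpleTransform-longest : ∀ {Q R} → SimpleTransform G v0 Q R → IsLongestV0Path G v0 R
    simpleTransform-longest
      (Q-longest@((_ , _ , _ , Q-linked) , _) , as , vj , u , bs , vk , refl , vk~vj , refl) =
      IsLongestV0Path-resp-↭ Q-longest (++⁺ˡ (as ∷ʳ vj) Y↭vk∷reversed) same-head
        (Linked-reverse-suffix Adj-sym as (u ∷ bs) vk~vj Q-linked)
      where
      Y↭vk∷reversed : (u ∷ bs) ∷ʳ vk ↭ vk ∷ reverse (u ∷ bs)
      Y↭vk∷reversed = ↭-trans (↭-sym (∷↭∷ʳ vk (u ∷ bs))) (↭-prep vk (↭-sym (↭-reverse (u ∷ bs))))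
      same-head : head ((as ∷ʳ vj) ++ vk ∷ reverse (u ∷ bs)) ≡ head ((as ∷ʳ vj) ++ (u ∷ bs) ∷ʳ vk)
      same-head = trans (head-∷ʳ-++ as vj _) (sym (head-∷ʳ-++ as vj _))

    transform-longest : ∀ {P Q} → IsLongestV0Path G v0 P → Transform G v0 P Q → IsLongestV0Path G v0 Q
    transform-longest P-longest here       = P-longest
    transform-longest _         (step _ s) = simpleTransform-longest s

    IsV0Path-∷ʳ : ∀ {Q v w} → IsV0Path G v0 (Q ∷ʳ v) → Adj G v w → w ∉ Q ∷ʳ v →
                  IsV0Path G v0 (Q ∷ʳ v ∷ʳ w)
    IsV0Path-∷ʳ {Q} {v} {w} (rest , eq , Qv! , Qv-linked) v~w w∉Qv =
      rest ∷ʳ w , cong (_∷ʳ w) eq ,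
      Unique-resp-↭ (∷↭∷ʳ w (Q ∷ʳ v)) (¬Any⇒All¬ _ w∉Qv ∷ Qv!) ,
      Linkedₚ.++⁺ Qv-linked (subst (λ m → Connected (Adj G) m (just w)) (sym (last-∷ʳ Q v)) (just v~w)) [-]

    neighbour∈longestPath : ∀ {Q v w} → IsLongestV0Path G v0 (Q ∷ʳ v) → Adj G v w → w ∈ Q
    neighbour∈longestPath {Q} {v} {w} (Qv-path , Qv-max) v~w with any? (w ≟ᶠ_) (Q ∷ʳ v)
    ... | no w∉Qv =
      contradiction (≤-trans (≤-reflexive (↭-length (∷↭∷ʳ w (Q ∷ʳ v))))
                             (Qv-max _ (IsV0Path-∷ʳ Qv-path v~w w∉Qv)))
                    (n≮n _)
    ... | yes w∈Qv with ∈-++⁻ Q w∈Qv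
    ...   | inj₁ w∈Q         = w∈Q
    ...   | inj₂ (here refl) = contradiction refl (Adj-irrefl v~w)

    successor∈L : ∀ {P Q v z} → Transform G v0 P (Q ∷ʳ v) → IsLongestV0Path G v0 (Q ∷ʳ v) →
                  z ∈ successors (Adj? v) (Q ∷ʳ v) → InL G v0 P z
    successor∈L {Q = Q} {v} {z} P⇝Qv Qv-longest z∈ with ∈-successors⁻ (Adj? v) (Q ∷ʳ v) z∈
    ... | as , a , bs , Qv≡ , v~a with initLast bs
    ...   | []       = Q ∷ʳ v , P⇝Qv , trans (cong last Qv≡) (last-∷ʳ (as ∷ʳ a) z)
    ...   | cs ∷ʳ′ c = R , step P⇝Qv (Qv-longest , as , a , z , cs , c , Qv≡ , c~a , refl) , last-R
      where
      X = as ∷ʳ a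
      R = X ++ c ∷ reverse (z ∷ cs)
      v≡c : v ≡ c
      v≡c = proj₂ (∷ʳ-injective Q (X ++ z ∷ cs) (trans Qv≡ (sym (++-assoc X (z ∷ cs) [ c ]))))
      c~a : Adj G c a
      c~a = subst (λ x → Adj G x a) v≡c v~a
      last-R : last R ≡ just z
      last-R = begin
        last (X ++ c ∷ reverse (z ∷ cs))   ≡⟨ cong (λ t → last (X ++ c ∷ t)) (unfold-reverse z cs) ⟩
        last (X ++ (c ∷ reverse cs) ∷ʳ z)  ≡⟨ cong last (++-assoc X (c ∷ reverse cs) [ z ]) ⟨
        last ((X ++ c ∷ reverse cs) ∷ʳ z)  ≡⟨ last-∷ʳ (X ++ c ∷ reverse cs) z ⟩
        just z                             ∎
        where open ≡-Reasoning

lemma2p20 : ∀ {n} (G : SimpleGraph n) (v0 : Fin n) (P : List (Fin n)) →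
    IsLongestV0Path G v0 P →
    (Ls : List (Fin n)) → Unique Ls →
    (∀ w → (w ∈ Ls → InL G v0 P w) × (InL G v0 P w → w ∈ Ls)) →
    ∀ v → InL G v0 P v → degree G v ≤ length Ls
lemma2p20 {n} G v0 P P-longest Ls _ Ls≡L v (Qv , P⇝Qv , last≡v)
  with last≡just⇒∷ʳ Qv last≡v | transform-longest G P-longest P⇝Qv
... | Q , refl | Qv-longest@((_ , _ , Qv! , _) , _) = begin
  degree G v                                  ≡⟨ degree≡length-neighbours G v ⟩
  length (neighbours G v)                     ≤⟨ Unique∧⊆⇒length≤ (filter⁺ (Adj? G v) (allFin⁺ n)) neighbours⊆Q ⟩
  length (filter (Adj? G v) Q)                ≡⟨ length-successors-∷ʳ (Adj? G v) Q v ⟨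
  length (successors (Adj? G v) (Q ∷ʳ v))     ≤⟨ Unique∧⊆⇒length≤ (Unique-successors (Adj? G v) (Q ∷ʳ v) Qv!) successors⊆Ls ⟩
  length Ls                                   ∎
  where
  open ≤-Reasoning
  neighbours⊆Q : neighbours G v ⊆ filter (Adj? G v) Q
  neighbours⊆Q w∈ with ∈-filter⁻ (Adj? G v) {xs = allFin n} w∈
  ... | _ , v~w = ∈-filter⁺ (Adj? G v) (neighbour∈longestPath G Qv-longest v~w) v~w
  successors⊆Ls : successors (Adj? G v) (Q ∷ʳ v) ⊆ Ls
  successors⊆Ls z∈ = proj₂ (Ls≡L _) (successor∈L G P⇝Qv Qv-longest z∈)
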